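{- For all formulas $A,B,C\in\mathsf{Form}_\supset$, the following are theorems of $\mathbf{S}$: (i) $(A\supset(B\supset C))\to(B\supset(A\supset C))$; (ii) $(B\to C)\to((A\supset B)\to(A\supset C))$.
   Context: Formulas $\mathsf{Form}_\supset$ are built from a countable set of propositional variables using binary connectives $\land,\lor,\to,\supset$. The proof system $\mathbf{S}$ has axiom schemata (for all formulas $A,B,C$) (Ax1) $A\to(B\to A)$; (Ax2) $(A\to(B\to C))\to((A\to B)\to(A\to C))$; (Ax3) $(A\land B)\to A$; (Ax4) $(A\land B)\to B$; (Ax5) $(C\to A)\to((C\to B)\to(C\to(A\land B)))$; (Ax6) $A\to(A\lor B)$; (Ax7) $B\to(A\lor B)$; (Ax8) $(A\to C)\to((B\to C)\to((A\lor B)\to C))$; (AxM1) $(A\to B)\supset(A\supset B)$; (AxM2) $(A\supset(B\supset C))\to((A\supset B)\supset(A\supset C))$; (AxM3) $(A\supset(B\to C))\to(B\to(A\supset C))$; (AxM4) $(A\to(B\supset C))\to(B\supset(A\to C))$; (AxM5) $((A\supset B)\supset C)\to((A\supset C)\to C)$; (AxM6) $(A\supset C)\to((B\supset C)\to((A\lor B)\supset C))$; and the single rule (MP): from $A$ and $A\supset B$ infer $B$. A theorem is a formula derivable from the empty set of assumptions using axiom instances and (MP). -}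

module Defs where

open import Data.Nat using (ℕ)

infixr 6 _∧_
infixr 5 _∨_
infixr 4 _⇒_ _⊃_

data Form : Set where
  var : ℕ → Form
  _∧_ : Form → Form → Form
  _∨_ : Form → Form → Form
  _⇒_ : Form → Form → Form   -- the connective →
  _⊃_ : Form → Form → Form

data Axiom : Form → Set where
  ax1  : ∀ A B → Axiom (A ⇒ (B ⇒ A))
  ax2  : ∀ A B C → Axiom ((A ⇒ (B ⇒ C)) ⇒ ((A ⇒ B) ⇒ (A ⇒ C)))
  ax3  : ∀ A B → Axiom ((A ∧ B) ⇒ A)
  ax4  : ∀ A B → Axiom ((A ∧ B) ⇒ B)
  ax5  : ∀ A B C → Axiom ((C ⇒ A) ⇒ ((C ⇒ B) ⇒ (C ⇒ (A ∧ B))))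
  ax6  : ∀ A B → Axiom (A ⇒ (A ∨ B))
  ax7  : ∀ A B → Axiom (B ⇒ (A ∨ B))
  ax8  : ∀ A B C → Axiom ((A ⇒ C) ⇒ ((B ⇒ C) ⇒ ((A ∨ B) ⇒ C)))
  axM1 : ∀ A B → Axiom ((A ⇒ B) ⊃ (A ⊃ B))
  axM2 : ∀ A B C → Axiom ((A ⊃ (B ⊃ C)) ⇒ ((A ⊃ B) ⊃ (A ⊃ C)))
  axM3 : ∀ A B C → Axiom ((A ⊃ (B ⇒ C)) ⇒ (B ⇒ (A ⊃ C)))
  axM4 : ∀ A B C → Axiom ((A ⇒ (B ⊃ C)) ⇒ (B ⊃ (A ⇒ C)))
  axM5 : ∀ A B C → Axiom (((A ⊃ B) ⊃ C) ⇒ ((A ⊃ C) ⇒ C))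
  axM6 : ∀ A B C → Axiom ((A ⊃ C) ⇒ ((B ⊃ C) ⇒ ((A ∨ B) ⊃ C)))

data Thm : Form → Set where
  axiom : ∀ {A} → Axiom A → Thm A
  mp    : ∀ {A B} → Thm A → Thm (A ⊃ B) → Thm B

module Submission where

-- Axioms Ax1, Ax2 give → a deduction theorem, and AxM1 lets modus ponens act on → as well
-- as on ⊃; with AxM2 this makes each A ⊃ _ a normal modality: necessitation plus closure
-- under provable →. Evaluation A ⊃ ((A ⊃ B) → B) comes from AxM4 applied to the identity.
-- For (ii), push B → C through evaluation under A ⊃ _ and move the antecedents outside with
-- AxM3. For (i), apply (ii) to B ⊃ C → C under B ⊃ _ starting from evaluation, then AxM3.

open import Defs
open import Data.Product using (_×_; _,_)
open import Data.List using (List; []; _∷_)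
open import Data.List.Membership.Propositional using (_∈_)
open import Data.List.Relation.Unary.Any using (here; there)
open import Relation.Binary.PropositionalEquality using (refl)

⇒-elim : ∀ {A B} → Thm A → Thm (A ⇒ B) → Thm B
⇒-elim {A} {B} a a⇒b = mp a (mp a⇒b (axiom (axM1 A B)))

⇒-refl : ∀ A → Thm (A ⇒ A)
⇒-refl A = ⇒-elim (axiom (ax1 A A))
             (⇒-elim (axiom (ax1 A (A ⇒ A))) (axiom (ax2 A (A ⇒ A) A)))

infix 3 _⊢_

data _⊢_ (Γ : List Form) : Form → Set where
  hyp : ∀ {A} → A ∈ Γ → Γ ⊢ A
  thm : ∀ {A} → Thm A → Γ ⊢ A
  app : ∀ {A B} → Γ ⊢ A ⇒ B → Γ ⊢ A → Γ ⊢ B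

deduction : ∀ {Γ A B} → A ∷ Γ ⊢ B → Γ ⊢ A ⇒ B
deduction {A = A} (hyp (here refl))    = thm (⇒-refl A)
deduction {A = A} (hyp {B} (there p))  = app (thm (axiom (ax1 B A))) (hyp p)
deduction {A = A} (thm {B} t)          = thm (⇒-elim t (axiom (ax1 B A)))
deduction {A = A} (app {C} {D} d e)    =
  app (app (thm (axiom (ax2 A C D))) (deduction d)) (deduction e)

closed : ∀ {A} → [] ⊢ A → Thm A
closed (hyp ())
closed (thm t)   = t
closed (app d e) = ⇒-elim (closed e) (closed d)

⇒-trans : ∀ X Y Z → Thm ((X ⇒ Y) ⇒ ((Y ⇒ Z) ⇒ (X ⇒ Z)))
⇒-trans X Y Z = closed (deduction (deduction (deduction
  (app (hyp y⇒z) (app (hyp x⇒y) (hyp x))))))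
  where
  x   = here refl
  y⇒z = there (here refl)
  x⇒y = there (there (here refl))

⇒-compose : ∀ {X Y Z} → Thm (X ⇒ Y) → Thm (Y ⇒ Z) → Thm (X ⇒ Z)
⇒-compose {X} {Y} {Z} x⇒y y⇒z = ⇒-elim y⇒z (⇒-elim x⇒y (⇒-trans X Y Z))

⊃-necessitation : ∀ {B} A → Thm B → Thm (A ⊃ B)
⊃-necessitation {B} A b = mp (⇒-elim b (axiom (ax1 B A))) (axiom (axM1 A B))

⊃-map : ∀ {A B C} → Thm (A ⊃ B) → Thm (B ⇒ C) → Thm (A ⊃ C)
⊃-map {A} {B} {C} a⊃b b⇒c =
  mp a⊃b (⇒-elim (⊃-necessitation A (mp b⇒c (axiom (axM1 B C)))) (axiom (axM2 A B C)))

⊃-eval : ∀ A B → Thm (A ⊃ ((A ⊃ B) ⇒ B))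
⊃-eval A B = ⇒-elim (⇒-refl (A ⊃ B)) (axiom (axM4 (A ⊃ B) A B))

⊃-monotone : ∀ A B C → Thm ((B ⇒ C) ⇒ ((A ⊃ B) ⇒ (A ⊃ C)))
⊃-monotone A B C = ⇒-compose under-A (axiom (axM3 A (A ⊃ B) C))
  where
  under-A : Thm ((B ⇒ C) ⇒ (A ⊃ ((A ⊃ B) ⇒ C)))
  under-A = ⇒-elim (⊃-map (⊃-eval A B) (⇒-trans (A ⊃ B) B C))
                   (axiom (axM3 A (B ⇒ C) ((A ⊃ B) ⇒ C)))

⊃-exchange : ∀ A B C → Thm ((A ⊃ (B ⊃ C)) ⇒ (B ⊃ (A ⊃ C)))
⊃-exchange A B C =
  ⇒-elim (⊃-map (⊃-eval B C) (⊃-monotone A (B ⊃ C) C))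
         (axiom (axM3 B (A ⊃ (B ⊃ C)) (A ⊃ C)))

mainTheorem8 : (A B C : Form) →
    Thm ((A ⊃ (B ⊃ C)) ⇒ (B ⊃ (A ⊃ C))) × Thm ((B ⇒ C) ⇒ ((A ⊃ B) ⇒ (A ⊃ C)))
mainTheorem8 A B C = ⊃-exchange A B C , ⊃-monotone A B C
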